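{- Let $m\ge 0$ and $n\ge 1$ be integers. Then $$H_{n,m+1}(x)=\frac{(mn+1)x+1-n}{(m+1)n}\sum_{\substack{i_1,\dots,i_{m+1}\ge 0\\ i_1+\cdots+i_{m+1}=n-1}}H_{i_1,m+1}(x)H_{i_2,m+1}(x)\cdots H_{i_{m+1},m+1}(x),$$ where for $j\ge 1$, $H_{j,m+1}(x)=\sum_{T\in\mathcal{T}_{m+1}(j)}\prod_{v\in\mathcal{I}(T)}\frac{(mh_v+1)x+1-h_v}{(m+1)h_v}$, and $H_{0,m+1}(x)=1$.
   Context: All trees are plane trees (rooted, children of each vertex linearly ordered, vertices unlabelled). A complete $p$-ary tree is a plane tree in which every internal (non-leaf) vertex has exactly $p$ children; $\mathcal{T}_p(j)$ denotes the set of complete $p$-ary trees with $j$ internal vertices (for $j=0$ this is the single-vertex tree). $\mathcal{I}(T)$ is the set of internal vertices of $T$, and for $v\in\mathcal{I}(T)$ the hook length $h_v$ is the number of internal vertices of the subtree rooted at $v$. -}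

module Defs where

open import Data.Nat as ℕ using (ℕ; zero; suc; NonZero)
open import Data.Integer using (+_)
open import Data.Rational using (ℚ; _/_; 1ℚ; 0ℚ; _+_; _*_; _-_)
open import Data.List as List using (List; []; _∷_; _++_; concatMap; upTo; filter)
open import Data.Vec as Vec using (Vec; []; _∷_)
open import Relation.Binary.PropositionalEquality using (_≡_)

data PTree (p : ℕ) : Set where
  leaf : PTree p
  node : Vec (PTree p) p → PTree p

mutual
  internal : ∀ {p} → PTree p → ℕ
  internal leaf = 0
  internal (node cs) = suc (internalVec cs)

  internalVec : ∀ {p k} → Vec (PTree p) k → ℕ
  internalVec [] = 0
  internalVec (t ∷ ts) = internal t ℕ.+ internalVec ts

mutual
  height : ∀ {p} → PTree p → ℕ
  height leaf = 0
  height (node cs) = suc (heightVec cs)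

  heightVec : ∀ {p k} → Vec (PTree p) k → ℕ
  heightVec [] = 0
  heightVec (t ∷ ts) = height t ℕ.⊔ heightVec ts

vecsOf : ∀ {A : Set} → List A → (k : ℕ) → List (Vec A k)
vecsOf xs zero = [] ∷ []
vecsOf xs (suc k) = concatMap (λ x → List.map (x ∷_) (vecsOf xs k)) xs

treesUpTo : (p h : ℕ) → List (PTree p)
treesUpTo p zero = leaf ∷ []
treesUpTo p (suc h) = leaf ∷ List.map node (vecsOf (treesUpTo p h) p)

-- 𝒯_p(j): the complete p-ary trees with j internal vertices
-- (any such tree has height ≤ j, so it occurs in treesUpTo p j).
𝒯 : (p j : ℕ) → List (PTree p)
𝒯 p j = filter (λ T → internal T ℕ.≟ j) (treesUpTo p j)

sumℚ : List ℚ → ℚ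
sumℚ = List.foldr _+_ 0ℚ

prodVecℚ : ∀ {k} → Vec ℚ k → ℚ
prodVecℚ = Vec.foldr _ _*_ 1ℚ

ℕ→ℚ : ℕ → ℚ
ℕ→ℚ k = + k / 1

factor : (m : ℕ) (x : ℚ) (h : ℕ) → .{{NonZero h}} → ℚ
factor m x h = ((ℕ→ℚ (m ℕ.* h ℕ.+ 1) * x + 1ℚ) - ℕ→ℚ h) * ((+ 1 / suc m) * (+ 1 / h))

-- ∏_{v ∈ 𝓘(T)} factor(h_v), h_v = number of internal vertices of the subtree at v
mutual
  weight : ∀ {p} (m : ℕ) (x : ℚ) → PTree p → ℚ
  weight m x leaf = 1ℚ
  weight m x (node cs) = factor m x (suc (internalVec cs)) * weightVec m x cs

  weightVec : ∀ {p k} (m : ℕ) (x : ℚ) → Vec (PTree p) k → ℚ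
  weightVec m x [] = 1ℚ
  weightVec m x (t ∷ ts) = weight m x t * weightVec m x ts

H : (m j : ℕ) (x : ℚ) → ℚ
H m zero x = 1ℚ
H m (suc j) x = sumℚ (List.map (weight m x) (𝒯 (suc m) (suc j)))

compositions : (k s : ℕ) → List (Vec ℕ k)
compositions k s = filter (λ v → Vec.sum v ℕ.≟ s) (vecsOf (upTo (suc s)) k)

{-# OPTIONS --safe #-}
module Submission where

open import Defs
open import Data.Nat using (ℕ; suc; NonZero; _∸_)
open import Data.Rational using (ℚ; _*_)
open import Data.List using (map)
open import Data.Vec using (Vec)
import Data.Vec as Vec
open import Relation.Binary.PropositionalEquality using (_≡_)

import Data.Nat as ℕ
open import Data.Nat using (zero; _≤_; _<_; z≤n; s≤s; _≟_; _<?_)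
open import Data.Nat.Properties
  using (suc-injective; ≤-pred; ≤-trans; ≤-reflexive; m≤m+n; m∸n≤m; m+[n∸m]≡n; m+n∸m≡n)
open import Data.Nat.Induction using (<-rec)
open import Data.Rational using (_+_; 0ℚ; 1ℚ)
open import Data.Rational.Properties
  using (+-identityʳ; +-identityˡ; +-assoc; *-zeroʳ; *-zeroˡ; *-distribˡ-+; *-comm; +-0-commutativeMonoid)
open import Algebra.Bundles using (CommutativeMonoid)
open import Algebra.Properties.CommutativeSemigroup
  (CommutativeMonoid.commutativeSemigroup +-0-commutativeMonoid) using (interchange)
open import Data.List using (List; []; _∷_; _++_; concatMap; upTo; applyUpTo; filter)
open import Data.Vec using ([]; _∷_)
open import Data.Bool using (if_then_else_)
open import Data.Empty using (⊥-elim)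
open import Relation.Nullary using (Dec; yes; no; does; ¬_)
open import Relation.Binary.PropositionalEquality
  using (refl; sym; trans; cong; cong₂; module ≡-Reasoning)
open import Function using (_∘_)

-- Splitting a tree at its root, a tree with n internal vertices is a root
-- carrying m+1 subtrees whose numbers of internal vertices form a
-- composition of n-1, and its weight is factor(n) times the product of the
-- weights of the subtrees.  Both sides of the recursion are therefore
-- coefficients of the (m+1)-st convolution power of j ↦ H_{j,m+1}: a sum over
-- vectors of weighted objects restricted to total size s is the coefficient
-- of s in the corresponding power of the size-generating function.  Since
-- the trees are enumerated by height, one also checks that trees of height
-- at most h already account for all trees with at most h internal vertices.

∑ : {A : Set} → List A → (A → ℚ) → ℚ
∑ []       f = 0ℚ
∑ (x ∷ xs) f = f x + ∑ xs f

sumℚ-map : {A : Set} (xs : List A) (f : A → ℚ) → sumℚ (map f xs) ≡ ∑ xs f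
sumℚ-map []       f = refl
sumℚ-map (x ∷ xs) f = cong (f x +_) (sumℚ-map xs f)

∑-cong : {A : Set} (xs : List A) {f g : A → ℚ} → (∀ x → f x ≡ g x) → ∑ xs f ≡ ∑ xs g
∑-cong []       f≡g = refl
∑-cong (x ∷ xs) f≡g = cong₂ _+_ (f≡g x) (∑-cong xs f≡g)

∑-zero : {A : Set} (xs : List A) → ∑ xs (λ _ → 0ℚ) ≡ 0ℚ
∑-zero []       = refl
∑-zero (x ∷ xs) = trans (+-identityˡ _) (∑-zero xs)

∑-+ : {A : Set} (xs : List A) (f g : A → ℚ) → ∑ xs (λ x → f x + g x) ≡ ∑ xs f + ∑ xs g
∑-+ []       f g = refl
∑-+ (x ∷ xs) f g =
  trans (cong (f x + g x +_) (∑-+ xs f g)) (interchange (f x) (g x) (∑ xs f) (∑ xs g))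

∑-*ˡ : {A : Set} (xs : List A) (c : ℚ) (f : A → ℚ) → ∑ xs (λ x → c * f x) ≡ c * ∑ xs f
∑-*ˡ []       c f = sym (*-zeroʳ c)
∑-*ˡ (x ∷ xs) c f = trans (cong (c * f x +_) (∑-*ˡ xs c f)) (sym (*-distribˡ-+ c (f x) (∑ xs f)))

∑-*ʳ : {A : Set} (xs : List A) (c : ℚ) (f : A → ℚ) → ∑ xs (λ x → f x * c) ≡ ∑ xs f * c
∑-*ʳ xs c f = begin
  ∑ xs (λ x → f x * c) ≡⟨ ∑-cong xs (λ x → *-comm (f x) c) ⟩
  ∑ xs (λ x → c * f x) ≡⟨ ∑-*ˡ xs c f ⟩
  c * ∑ xs f           ≡⟨ *-comm c (∑ xs f) ⟩
  ∑ xs f * c           ∎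
  where open ≡-Reasoning

∑-map : {A B : Set} (g : A → B) (xs : List A) (f : B → ℚ) → ∑ (map g xs) f ≡ ∑ xs (f ∘ g)
∑-map g []       f = refl
∑-map g (x ∷ xs) f = cong (f (g x) +_) (∑-map g xs f)

∑-++ : {A : Set} (xs ys : List A) (f : A → ℚ) → ∑ (xs ++ ys) f ≡ ∑ xs f + ∑ ys f
∑-++ []       ys f = sym (+-identityˡ _)
∑-++ (x ∷ xs) ys f = trans (cong (f x +_) (∑-++ xs ys f)) (sym (+-assoc (f x) _ _))

∑-concatMap : {A B : Set} (g : A → List B) (xs : List A) (f : B → ℚ) →
  ∑ (concatMap g xs) f ≡ ∑ xs (λ x → ∑ (g x) f)
∑-concatMap g []       f = refl
∑-concatMap g (x ∷ xs) f =
  trans (∑-++ (g x) (concatMap g xs) f) (cong (∑ (g x) f +_) (∑-concatMap g xs f))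

∑-comm : {A B : Set} (xs : List A) (ys : List B) (f : A → B → ℚ) →
  ∑ xs (λ x → ∑ ys (f x)) ≡ ∑ ys (λ y → ∑ xs (λ x → f x y))
∑-comm []       ys f = sym (∑-zero ys)
∑-comm (x ∷ xs) ys f =
  trans (cong (∑ ys (f x) +_) (∑-comm xs ys f)) (sym (∑-+ ys (f x) (λ y → ∑ xs (λ x′ → f x′ y))))

when : {P : Set} → Dec P → ℚ → ℚ
when d q = if does d then q else 0ℚ

when-yes : {P : Set} (d : Dec P) → P → ∀ q → when d q ≡ q
when-yes (yes _) p  q = refl
when-yes (no ¬p) p  q = ⊥-elim (¬p p)

when-no : {P : Set} (d : Dec P) → ¬ P → ∀ q → when d q ≡ 0ℚ
when-no (yes p) ¬p q = ⊥-elim (¬p p)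
when-no (no _)  ¬p q = refl

when-⇔ : {P Q : Set} (d : Dec P) (e : Dec Q) → (P → Q) → (Q → P) → ∀ q → when d q ≡ when e q
when-⇔ (yes p) e to from q = sym (when-yes e (to p) q)
when-⇔ (no ¬p) e to from q = sym (when-no e (¬p ∘ from) q)

when-*ʳ : {P : Set} (d : Dec P) (x y : ℚ) → when d x * y ≡ when d (x * y)
when-*ʳ (yes _) x y = refl
when-*ʳ (no _)  x y = *-zeroˡ y

when-*ˡ : {P : Set} (d : Dec P) (x y : ℚ) → x * when d y ≡ when d (x * y)
when-*ˡ (yes _) x y = refl
when-*ˡ (no _)  x y = *-zeroʳ x

∑-filter : {A : Set} {P : A → Set} (P? : ∀ x → Dec (P x)) (xs : List A) (f : A → ℚ) →
  ∑ (filter P? xs) f ≡ ∑ xs (λ x → when (P? x) (f x))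
∑-filter P? []       f = refl
∑-filter P? (x ∷ xs) f with P? x
... | yes _ = cong (f x +_) (∑-filter P? xs f)
... | no _  = trans (∑-filter P? xs f) (sym (+-identityˡ _))

∑< : ℕ → (ℕ → ℚ) → ℚ
∑< zero    φ = 0ℚ
∑< (suc n) φ = φ 0 + ∑< n (φ ∘ suc)

∑-applyUpTo : (g : ℕ → ℕ) (n : ℕ) (f : ℕ → ℚ) → ∑ (applyUpTo g n) f ≡ ∑< n (f ∘ g)
∑-applyUpTo g zero    f = refl
∑-applyUpTo g (suc n) f = cong (f (g 0) +_) (∑-applyUpTo (g ∘ suc) n f)

∑-upTo : (n : ℕ) (f : ℕ → ℚ) → ∑ (upTo n) f ≡ ∑< n f
∑-upTo = ∑-applyUpTo (λ i → i)

∑<-cong : ∀ n {φ ψ : ℕ → ℚ} → (∀ i → i < n → φ i ≡ ψ i) → ∑< n φ ≡ ∑< n ψ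
∑<-cong zero    φ≡ψ = refl
∑<-cong (suc n) φ≡ψ = cong₂ _+_ (φ≡ψ 0 (s≤s z≤n)) (∑<-cong n (λ i i<n → φ≡ψ (suc i) (s≤s i<n)))

∑<-zero : ∀ n → ∑< n (λ _ → 0ℚ) ≡ 0ℚ
∑<-zero zero    = refl
∑<-zero (suc n) = trans (+-identityˡ _) (∑<-zero n)

∑<-when≟ : ∀ n a (f : ℕ → ℚ) → ∑< n (λ i → when (a ≟ i) (f i)) ≡ when (a <? n) (f a)
∑<-when≟ zero    a       f = sym (when-no (a <? 0) (λ ()) (f a))
∑<-when≟ (suc n) zero    f = begin
  f 0 + ∑< n (λ i → when (0 ≟ suc i) (f (suc i)))
    ≡⟨ cong (f 0 +_) (∑<-cong n (λ i _ → when-no (0 ≟ suc i) (λ ()) (f (suc i)))) ⟩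
  f 0 + ∑< n (λ _ → 0ℚ)    ≡⟨ cong (f 0 +_) (∑<-zero n) ⟩
  f 0 + 0ℚ                 ≡⟨ +-identityʳ (f 0) ⟩
  f 0                      ≡⟨ sym (when-yes (0 <? suc n) (s≤s z≤n) (f 0)) ⟩
  when (0 <? suc n) (f 0)  ∎
  where open ≡-Reasoning
∑<-when≟ (suc n) (suc a) f = begin
  when (suc a ≟ 0) (f 0) + ∑< n (λ i → when (suc a ≟ suc i) (f (suc i)))
    ≡⟨ cong₂ _+_ (when-no (suc a ≟ 0) (λ ()) (f 0))
                 (∑<-cong n (λ i _ → when-⇔ (suc a ≟ suc i) (a ≟ i) suc-injective (cong suc) _)) ⟩
  0ℚ + ∑< n (λ i → when (a ≟ i) (f (suc i)))
    ≡⟨ +-identityˡ _ ⟩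
  ∑< n (λ i → when (a ≟ i) (f (suc i)))
    ≡⟨ ∑<-when≟ n a (f ∘ suc) ⟩
  when (a <? n) (f (suc a))
    ≡⟨ when-⇔ (a <? n) (suc a <? suc n) s≤s ≤-pred _ ⟩
  when (suc a <? suc n) (f (suc a)) ∎
  where open ≡-Reasoning

when-+≟ : ∀ a b s (x y : ℚ) →
  when (a ℕ.+ b ≟ s) (x * y) ≡ ∑< (suc s) (λ i → when (a ≟ i) x * when (b ≟ s ∸ i) y)
when-+≟ a b s x y = sym (begin
  ∑< (suc s) (λ i → when (a ≟ i) x * when (b ≟ s ∸ i) y)
    ≡⟨ ∑<-cong (suc s) (λ i _ → when-*ʳ (a ≟ i) x (when (b ≟ s ∸ i) y)) ⟩
  ∑< (suc s) (λ i → when (a ≟ i) (x * when (b ≟ s ∸ i) y))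
    ≡⟨ ∑<-when≟ (suc s) a (λ i → x * when (b ≟ s ∸ i) y) ⟩
  when (a <? suc s) (x * when (b ≟ s ∸ a) y)
    ≡⟨ split (a <? suc s) ⟩
  when (a ℕ.+ b ≟ s) (x * y) ∎)
  where
  open ≡-Reasoning
  split : Dec (a < suc s) → when (a <? suc s) (x * when (b ≟ s ∸ a) y) ≡ when (a ℕ.+ b ≟ s) (x * y)
  split (yes a<1+s) = begin
    when (a <? suc s) (x * when (b ≟ s ∸ a) y) ≡⟨ when-yes (a <? suc s) a<1+s _ ⟩
    x * when (b ≟ s ∸ a) y                     ≡⟨ cong (x *_) (when-⇔ (b ≟ s ∸ a) (a ℕ.+ b ≟ s) to from y) ⟩
    x * when (a ℕ.+ b ≟ s) y                   ≡⟨ when-*ˡ (a ℕ.+ b ≟ s) x y ⟩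
    when (a ℕ.+ b ≟ s) (x * y)                 ∎
    where
    to : b ≡ s ∸ a → a ℕ.+ b ≡ s
    to b≡s∸a = trans (cong (a ℕ.+_) b≡s∸a) (m+[n∸m]≡n (≤-pred a<1+s))
    from : a ℕ.+ b ≡ s → b ≡ s ∸ a
    from a+b≡s = trans (sym (m+n∸m≡n a b)) (cong (_∸ a) a+b≡s)
  split (no a≮1+s) = trans (when-no (a <? suc s) a≮1+s _)
    (sym (when-no (a ℕ.+ b ≟ s) (λ a+b≡s → a≮1+s (s≤s (≤-trans (m≤m+n a b) (≤-reflexive a+b≡s))))
                  (x * y)))

-- convPower f k s is the coefficient of zˢ in (∑ᵢ f i zⁱ)ᵏ.
convPower : (ℕ → ℚ) → ℕ → ℕ → ℚ
convPower f zero    s = when (0 ≟ s) 1ℚ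
convPower f (suc k) s = ∑< (suc s) (λ i → f i * convPower f k (s ∸ i))

convPower-cong : ∀ (f g : ℕ → ℚ) k s → (∀ i → i ≤ s → f i ≡ g i) → convPower f k s ≡ convPower g k s
convPower-cong f g zero    s f≡g = refl
convPower-cong f g (suc k) s f≡g = ∑<-cong (suc s) λ i i<1+s →
  cong₂ _*_ (f≡g i (≤-pred i<1+s))
            (convPower-cong f g k (s ∸ i) (λ i′ i′≤s∸i → f≡g i′ (≤-trans i′≤s∸i (m∸n≤m s i))))

module SizedVectors {A : Set} (xs : List A) (size : A → ℕ) (weightOf : A → ℚ)
  (sizeVec : ∀ {k} → Vec A k → ℕ) (weightVec : ∀ {k} → Vec A k → ℚ)
  (sizeVec-[] : sizeVec [] ≡ 0)
  (sizeVec-∷ : ∀ {k} t (ts : Vec A k) → sizeVec (t ∷ ts) ≡ size t ℕ.+ sizeVec ts)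
  (weightVec-[] : weightVec [] ≡ 1ℚ)
  (weightVec-∷ : ∀ {k} t (ts : Vec A k) → weightVec (t ∷ ts) ≡ weightOf t * weightVec ts) where

  gf : ℕ → ℚ
  gf i = ∑ xs (λ t → when (size t ≟ i) (weightOf t))

  vecGf : ℕ → ℕ → ℚ
  vecGf k s = ∑ (vecsOf xs k) (λ ts → when (sizeVec ts ≟ s) (weightVec ts))

  vecGf≡convPower : ∀ k s → vecGf k s ≡ convPower gf k s
  vecGf≡convPower zero    s rewrite sizeVec-[] | weightVec-[] = +-identityʳ _
  vecGf≡convPower (suc k) s = begin
      ∑ (concatMap (λ t → map (t ∷_) V) xs) F
    ≡⟨ ∑-concatMap (λ t → map (t ∷_) V) xs F ⟩
      ∑ xs (λ t → ∑ (map (t ∷_) V) F)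
    ≡⟨ ∑-cong xs (λ t → trans (∑-map (t ∷_) V F) (∑-cong V (F-∷ t))) ⟩
      ∑ xs (λ t → ∑ V (λ ts → ∑ I (λ i → a t i * b ts i)))
    ≡⟨ ∑-cong xs (λ t → ∑-comm V I (λ ts i → a t i * b ts i)) ⟩
      ∑ xs (λ t → ∑ I (λ i → ∑ V (λ ts → a t i * b ts i)))
    ≡⟨ ∑-comm xs I (λ t i → ∑ V (λ ts → a t i * b ts i)) ⟩
      ∑ I (λ i → ∑ xs (λ t → ∑ V (λ ts → a t i * b ts i)))
    ≡⟨ ∑-cong I (λ i → trans (∑-cong xs (λ t → ∑-*ˡ V (a t i) (λ ts → b ts i)))
                             (∑-*ʳ xs (vecGf k (s ∸ i)) (λ t → a t i))) ⟩
      ∑ I (λ i → gf i * vecGf k (s ∸ i))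
    ≡⟨ ∑-cong I (λ i → cong (gf i *_) (vecGf≡convPower k (s ∸ i))) ⟩
      ∑ I (λ i → gf i * convPower gf k (s ∸ i))
    ≡⟨ ∑-upTo (suc s) (λ i → gf i * convPower gf k (s ∸ i)) ⟩
      convPower gf (suc k) s ∎
    where
    open ≡-Reasoning
    V = vecsOf xs k
    I = upTo (suc s)
    F : Vec A (suc k) → ℚ
    F ts = when (sizeVec ts ≟ s) (weightVec ts)
    a : A → ℕ → ℚ
    a t i = when (size t ≟ i) (weightOf t)
    b : Vec A k → ℕ → ℚ
    b ts i = when (sizeVec ts ≟ s ∸ i) (weightVec ts)
    F-∷ : ∀ t ts → F (t ∷ ts) ≡ ∑ I (λ i → a t i * b ts i)
    F-∷ t ts rewrite sizeVec-∷ t ts | weightVec-∷ t ts =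
      trans (when-+≟ (size t) (sizeVec ts) s (weightOf t) (weightVec ts)) (sym (∑-upTo (suc s) (λ i → a t i * b ts i)))

sumℚ-compositions : (f : ℕ → ℚ) (k s : ℕ) →
  sumℚ (map (λ v → prodVecℚ (Vec.map f v)) (compositions k s)) ≡ convPower f k s
sumℚ-compositions f k s = begin
  sumℚ (map P (compositions k s))                            ≡⟨ sumℚ-map (compositions k s) P ⟩
  ∑ (compositions k s) P                                     ≡⟨ ∑-filter (λ v → Vec.sum v ≟ s) (vecsOf (upTo (suc s)) k) P ⟩
  vecGf k s                                                  ≡⟨ vecGf≡convPower k s ⟩
  convPower gf k s                                           ≡⟨ convPower-cong gf f k s gf≡f ⟩
  convPower f k s                                            ∎
  where
  open ≡-Reasoning
  P : ∀ {k} → Vec ℕ k → ℚ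
  P v = prodVecℚ (Vec.map f v)
  open SizedVectors (upTo (suc s)) (λ i → i) f Vec.sum P refl (λ _ _ → refl) refl (λ _ _ → refl)
  gf≡f : ∀ i → i ≤ s → gf i ≡ f i
  gf≡f i i≤s = begin
    ∑ (upTo (suc s)) (λ t → when (t ≟ i) (f t)) ≡⟨ ∑-upTo (suc s) (λ t → when (t ≟ i) (f t)) ⟩
    ∑< (suc s) (λ t → when (t ≟ i) (f t))       ≡⟨ ∑<-cong (suc s) (λ t _ → when-⇔ (t ≟ i) (i ≟ t) sym sym (f t)) ⟩
    ∑< (suc s) (λ t → when (i ≟ t) (f t))       ≡⟨ ∑<-when≟ (suc s) i f ⟩
    when (i <? suc s) (f i)                     ≡⟨ when-yes (i <? suc s) (s≤s i≤s) (f i) ⟩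
    f i                                         ∎

module _ (m : ℕ) (x : ℚ) where

  treeGf : ℕ → ℕ → ℚ
  treeGf h i = ∑ (treesUpTo (suc m) h) (λ t → when (internal t ≟ i) (weight m x t))

  H-suc≡treeGf : ∀ j → H m (suc j) x ≡ treeGf (suc j) (suc j)
  H-suc≡treeGf j = trans (sumℚ-map (𝒯 (suc m) (suc j)) (weight m x))
    (∑-filter (λ t → internal t ≟ suc j) (treesUpTo (suc m) (suc j)) (weight m x))

  treeGf-zero : ∀ h → treeGf h 0 ≡ 1ℚ
  treeGf-zero zero    = +-identityʳ 1ℚ
  treeGf-zero (suc h) = begin
    1ℚ + ∑ (map node V) (λ t → when (internal t ≟ 0) (weight m x t))
      ≡⟨ cong (1ℚ +_) (∑-map node V _) ⟩
    1ℚ + ∑ V (λ cs → when (suc (internalVec cs) ≟ 0) (weight m x (node cs)))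
      ≡⟨ cong (1ℚ +_) (∑-cong V (λ cs → when-no (suc (internalVec cs) ≟ 0) (λ ()) (weight m x (node cs)))) ⟩
    1ℚ + ∑ V (λ _ → 0ℚ)
      ≡⟨ cong (1ℚ +_) (∑-zero V) ⟩
    1ℚ + 0ℚ
      ≡⟨ +-identityʳ 1ℚ ⟩
    1ℚ ∎
    where
    open ≡-Reasoning
    V = vecsOf (treesUpTo (suc m) h) (suc m)

  when-factor : ∀ k i q → when (suc k ≟ suc i) (factor m x (suc k) * q) ≡ factor m x (suc i) * when (k ≟ i) q
  when-factor k i q = begin
    when (suc k ≟ suc i) (factor m x (suc k) * q)  ≡⟨ when-⇔ (suc k ≟ suc i) (k ≟ i) suc-injective (cong suc) _ ⟩
    when (k ≟ i) (factor m x (suc k) * q)          ≡⟨ when-factor-cong (k ≟ i) ⟩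
    when (k ≟ i) (factor m x (suc i) * q)          ≡⟨ sym (when-*ˡ (k ≟ i) (factor m x (suc i)) q) ⟩
    factor m x (suc i) * when (k ≟ i) q            ∎
    where
    open ≡-Reasoning
    when-factor-cong : (d : Dec (k ≡ i)) → when d (factor m x (suc k) * q) ≡ when d (factor m x (suc i) * q)
    when-factor-cong (yes refl) = refl
    when-factor-cong (no _)     = refl

  treeGf-suc : ∀ h i → treeGf (suc h) (suc i) ≡ factor m x (suc i) * convPower (treeGf h) (suc m) i
  treeGf-suc h i = begin
    when (0 ≟ suc i) 1ℚ + ∑ (map node V) f
      ≡⟨ cong (_+ ∑ (map node V) f) (when-no (0 ≟ suc i) (λ ()) 1ℚ) ⟩
    0ℚ + ∑ (map node V) f
      ≡⟨ +-identityˡ _ ⟩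
    ∑ (map node V) f
      ≡⟨ ∑-map node V f ⟩
    ∑ V (f ∘ node)
      ≡⟨ ∑-cong V (λ cs → when-factor (internalVec cs) i (weightVec m x cs)) ⟩
    ∑ V (λ cs → factor m x (suc i) * when (internalVec cs ≟ i) (weightVec m x cs))
      ≡⟨ ∑-*ˡ V (factor m x (suc i)) _ ⟩
    factor m x (suc i) * vecGf (suc m) i
      ≡⟨ cong (factor m x (suc i) *_) (vecGf≡convPower (suc m) i) ⟩
    factor m x (suc i) * convPower (treeGf h) (suc m) i ∎
    where
    open ≡-Reasoning
    open SizedVectors (treesUpTo (suc m) h) internal (weight m x) internalVec (weightVec m x)
      refl (λ _ _ → refl) refl (λ _ _ → refl)
    V = vecsOf (treesUpTo (suc m) h) (suc m)
    f : PTree (suc m) → ℚ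
    f t = when (internal t ≟ suc i) (weight m x t)

  treeGf-stable : ∀ i h → i ≤ h → treeGf h i ≡ H m i x
  treeGf-stable = <-rec (λ i → ∀ h → i ≤ h → treeGf h i ≡ H m i x) step
    where
    step : ∀ i → (∀ {i′} → i′ < i → ∀ h → i′ ≤ h → treeGf h i′ ≡ H m i′ x) →
           ∀ h → i ≤ h → treeGf h i ≡ H m i x
    step zero    rec h       _           = treeGf-zero h
    step (suc i) rec (suc h) (s≤s i≤h) = begin
      treeGf (suc h) (suc i)                                 ≡⟨ treeGf-suc h i ⟩
      factor m x (suc i) * convPower (treeGf h) (suc m) i    ≡⟨ cong (factor m x (suc i) *_) (agrees i≤h) ⟩
      factor m x (suc i) * convPower (treeGf i) (suc m) i    ≡⟨ sym (treeGf-suc i i) ⟩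
      treeGf (suc i) (suc i)                                 ≡⟨ sym (H-suc≡treeGf i) ⟩
      H m (suc i) x                                          ∎
      where
      open ≡-Reasoning
      toH : ∀ {h} → i ≤ h → ∀ i′ → i′ ≤ i → treeGf h i′ ≡ H m i′ x
      toH i≤h i′ i′≤i = rec (s≤s i′≤i) _ (≤-trans i′≤i i≤h)
      agrees : ∀ {h} → i ≤ h → convPower (treeGf h) (suc m) i ≡ convPower (treeGf i) (suc m) i
      agrees i≤h = trans (convPower-cong _ _ (suc m) i (toH i≤h))
                         (sym (convPower-cong _ _ (suc m) i (toH (≤-reflexive refl))))

  H-suc : ∀ j → H m (suc j) x ≡ factor m x (suc j) * convPower (λ i → H m i x) (suc m) j
  H-suc j = begin
    H m (suc j) x                                           ≡⟨ H-suc≡treeGf j ⟩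
    treeGf (suc j) (suc j)                                  ≡⟨ treeGf-suc j j ⟩
    factor m x (suc j) * convPower (treeGf j) (suc m) j     ≡⟨ cong (factor m x (suc j) *_) agrees ⟩
    factor m x (suc j) * convPower (λ i → H m i x) (suc m) j ∎
    where
    open ≡-Reasoning
    agrees : convPower (treeGf j) (suc m) j ≡ convPower (λ i → H m i x) (suc m) j
    agrees = convPower-cong _ _ (suc m) j (λ i i≤j → treeGf-stable i j i≤j)

lemma3p2 : (m n : ℕ) → .{{_ : NonZero n}} → (x : ℚ) →
    H m n x ≡ factor m x n
      * sumℚ (map (λ (i : Vec ℕ (suc m)) → prodVecℚ (Vec.map (λ j → H m j x) i))
                  (compositions (suc m) (n ∸ 1)))
lemma3p2 m (suc j) x = begin
  H m (suc j) x                                         ≡⟨ H-suc m x j ⟩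
  factor m x (suc j) * convPower (λ i → H m i x) (suc m) j
    ≡⟨ cong (factor m x (suc j) *_) (sym (sumℚ-compositions (λ i → H m i x) (suc m) j)) ⟩
  factor m x (suc j) * sumℚ (map (λ i → prodVecℚ (Vec.map (λ i → H m i x) i)) (compositions (suc m) j)) ∎
  where open ≡-Reasoning
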